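{- Let $a\geq 3$ and $m\geq 2a^2-a+2$ be integers, let $C(m,a)=\left\lceil\frac{m-1}{a}\left\lceil\frac{m-1}{a}\right\rceil\right\rceil$, and suppose the set $\{1,\ldots,C(m,a)\}$ is colored red and blue so that there is no monochromatic solution of $x_1+\cdots+x_{m-1}=ax_m$, with both $a-2$ and $a-1$ red. Then $1$ is red.
   Context: A solution is an assignment of values in $\{1,\ldots,C(m,a)\}$ to $x_1,\ldots,x_m$ (not necessarily distinct) making the equation true; it is monochromatic if all the values $x_1,\ldots,x_m$ have the same color. -}

module Defs where

open import Data.Nat using (ℕ; zero; suc; _+_; _*_; _∸_; _≤_; NonZero)
open import Data.Nat.DivMod using (_/_)
open import Data.Bool using (Bool; true; false)
open import Data.Fin using (Fin)
open import Data.Vec.Functional using (Vector; foldr)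
open import Data.Product using (_×_; ∃; Σ)
open import Relation.Binary.PropositionalEquality using (_≡_)

Colour : Set
Colour = Bool

red blue : Colour
red  = true
blue = false

⌈_/_⌉ : (n d : ℕ) → .{{NonZero d}} → ℕ
⌈ n / d ⌉ = (n + (d ∸ 1)) / d

-- C(m,a) = ⌈ ((m-1)/a) · ⌈(m-1)/a⌉ ⌉ = ⌈ (m-1)·⌈(m-1)/a⌉ / a ⌉
-- (a is written as suc (a ∸ 1), which equals a whenever a ≥ 1; only used for a ≥ 3)
C : (m a : ℕ) → ℕ
C m a = ⌈ (m ∸ 1) * ⌈ (m ∸ 1) / suc (a ∸ 1) ⌉ / suc (a ∸ 1) ⌉

Σv : ∀ {k} → Vector ℕ k → ℕ
Σv = foldr _+_ 0

InRange : ℕ → ℕ → Set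
InRange N x = 1 ≤ x × x ≤ N

MonoSolution : (m a N : ℕ) → (ℕ → Colour) → Set
MonoSolution m a N c =
  Σ (Vector ℕ (m ∸ 1)) λ xs → Σ ℕ λ y →
    (∀ i → InRange N (xs i)) × InRange N y ×
    (Σv xs ≡ a * y) ×
    ((∀ i → c (xs i) ≡ c y))

module Submission where

-- Write a = u + 2 (so a − 2 = u, a − 1 = u + 1) and w = m − a; the
-- equation has m − 1 = (u + 1) + w unknowns on the left.  Suppose 1 were blue.
--   * If w is blue, then (u + 1) copies of w together with w copies of 1 give
--     (u + 1)·w + w·1 = a·w, a blue solution with x_m = w.
--   * If w is red, write w = u² + t.  Then one copy of w, (u + 1)·u copies of u
--     and t copies of u + 1 give w + (u + 1)u·u + t(u + 1) = a·w, a red solution.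
-- Either way a monochromatic solution exists, provided all values used lie in
-- {1,…,C(m,a)}; this holds because w ≤ m − 1 ≤ C(m,a) once m − 1 > a(a − 1).

open import Defs
open import Data.Nat using (ℕ; zero; suc; _+_; _*_; _∸_; _^_; _≤_; s≤s; z≤n; NonZero; _/_)
open import Data.Nat.Properties
open import Data.Nat.DivMod using (m*n/n≡m; /-monoˡ-≤)
open import Data.Nat.Tactic.RingSolver using (solve-∀)
open import Data.Bool using (true; false)
open import Data.Fin using (Fin; zero; suc)
open import Data.Fin.Base using (splitAt)
open import Data.Sum using (inj₁; inj₂)
open import Data.Vec.Functional using (Vector; replicate; _++_; _∷_)
open import Data.Product using (_×_; _,_; proj₁; proj₂)
open import Data.Empty using (⊥-elim)
open import Relation.Nullary using (¬_)
open import Relation.Binary.PropositionalEquality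

private
  variable
    k l : ℕ

Σv-cong : {xs ys : Vector ℕ l} → (∀ i → xs i ≡ ys i) → Σv xs ≡ Σv ys
Σv-cong {zero}  xs≗ys = refl
Σv-cong {suc l} xs≗ys = cong₂ _+_ (xs≗ys zero) (Σv-cong (λ i → xs≗ys (suc i)))

tail-++ : (xs : Vector ℕ (suc k)) (ys : Vector ℕ l) (i : Fin (k + l)) →
          (xs ++ ys) (suc i) ≡ ((λ j → xs (suc j)) ++ ys) i
tail-++ {k} xs ys i with splitAt k i
... | inj₁ j = refl
... | inj₂ j = refl

Σv-++ : (xs : Vector ℕ k) (ys : Vector ℕ l) → Σv (xs ++ ys) ≡ Σv xs + Σv ys
Σv-++ {zero}  xs ys = refl
Σv-++ {suc k} xs ys = begin
  xs zero + Σv (λ i → (xs ++ ys) (suc i))      ≡⟨ cong (xs zero +_) (Σv-cong (tail-++ xs ys)) ⟩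
  xs zero + Σv ((λ i → xs (suc i)) ++ ys)     ≡⟨ cong (xs zero +_) (Σv-++ (λ i → xs (suc i)) ys) ⟩
  xs zero + (Σv (λ i → xs (suc i)) + Σv ys)   ≡⟨ +-assoc (xs zero) _ _ ⟨
  Σv xs + Σv ys                               ∎
  where open ≡-Reasoning

Σv-replicate : ∀ n x → Σv (replicate n x) ≡ n * x
Σv-replicate zero    x = refl
Σv-replicate (suc n) x = cong (x +_) (Σv-replicate n x)

++-all : (P : ℕ → Set) (xs : Vector ℕ k) (ys : Vector ℕ l) →
         (∀ i → P (xs i)) → (∀ i → P (ys i)) → ∀ i → P ((xs ++ ys) i)
++-all {k} P xs ys Pxs Pys i with splitAt k i
... | inj₁ j = Pxs j
... | inj₂ j = Pys j

Admissible : (N : ℕ) (c : ℕ → Colour) (col : Colour) (x : ℕ) → Set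
Admissible N c col x = InRange N x × c x ≡ col

solution : ∀ {m a N c col} (xs : Vector ℕ l) (y : ℕ) → m ∸ 1 ≡ l →
           (∀ i → Admissible N c col (xs i)) → Admissible N c col y →
           Σv xs ≡ a * y → MonoSolution m a N c
solution xs y refl xs-adm (y-range , cy) sum-eq =
  xs , y , (λ i → proj₁ (xs-adm i)) , y-range , sum-eq ,
  (λ i → trans (proj₂ (xs-adm i)) (sym cy))

onesSolution : ∀ {N c col} m k w → m ∸ 1 ≡ k + w →
               Admissible N c col 1 → Admissible N c col w →
               MonoSolution m (suc k) N c
onesSolution {N} {c} {col} m k w len one-adm w-adm =
  solution {m = m} {a = suc k} (replicate k w ++ replicate w 1) w len
    (++-all (Admissible N c col) (replicate k w) (replicate w 1) (λ _ → w-adm) (λ _ → one-adm))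
    w-adm sum-eq
  where
  open ≡-Reasoning
  sum-eq : Σv (replicate k w ++ replicate w 1) ≡ suc k * w
  sum-eq = begin
    Σv (replicate k w ++ replicate w 1)          ≡⟨ Σv-++ (replicate k w) (replicate w 1) ⟩
    Σv (replicate k w) + Σv (replicate w 1)      ≡⟨ cong₂ _+_ (Σv-replicate k w) (Σv-replicate w 1) ⟩
    k * w + w * 1                               ≡⟨ cong (k * w +_) (*-identityʳ w) ⟩
    k * w + w                                   ≡⟨ +-comm (k * w) w ⟩
    suc k * w                                   ∎

nearSolution : ∀ {N c col} m u t w → m ∸ 1 ≡ 1 + (suc u * u + t) → w ≡ u * u + t →
               Admissible N c col u → Admissible N c col (suc u) → Admissible N c col w →
               MonoSolution m (2 + u) N c
nearSolution {N} {c} {col} m u t w len w≡ u-adm su-adm w-adm =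
  solution {m = m} {a = 2 + u} (w ∷ blocks) w len entries-adm w-adm sum-eq
  where
  blocks : Vector ℕ (suc u * u + t)
  blocks = replicate (suc u * u) u ++ replicate t (suc u)

  entries-adm : ∀ i → Admissible N c col ((w ∷ blocks) i)
  entries-adm zero    = w-adm
  entries-adm (suc i) = ++-all (Admissible N c col) (replicate (suc u * u) u)
                          (replicate t (suc u)) (λ _ → u-adm) (λ _ → su-adm) i

  identity : ∀ u t → (u * u + t) + (suc u * u * u + t * suc u) ≡ (2 + u) * (u * u + t)
  identity = solve-∀

  open ≡-Reasoning
  sum-eq : Σv (w ∷ blocks) ≡ (2 + u) * w
  sum-eq = begin
    w + Σv blocks                               ≡⟨ cong (w +_) (Σv-++ (replicate (suc u * u) u) (replicate t (suc u))) ⟩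
    w + (Σv (replicate (suc u * u) u) + Σv (replicate t (suc u)))
      ≡⟨ cong (w +_) (cong₂ _+_ (Σv-replicate (suc u * u) u) (Σv-replicate t (suc u))) ⟩
    w + (suc u * u * u + t * suc u)             ≡⟨ cong (λ v → v + (suc u * u * u + t * suc u)) w≡ ⟩
    (u * u + t) + (suc u * u * u + t * suc u)   ≡⟨ identity u t ⟩
    (2 + u) * (u * u + t)                       ≡⟨ cong ((2 + u) *_) w≡ ⟨
    (2 + u) * w                                 ∎

oneIsRed : ∀ {N} m u t w → m ∸ 1 ≡ suc u + w → w ≡ u * u + t →
           1 ≤ u → suc u ≤ w → w ≤ N →
           (c : ℕ → Colour) → ¬ MonoSolution m (2 + u) N c →
           c u ≡ red → c (suc u) ≡ red → c 1 ≡ red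
oneIsRed {N} m u t w len w≡ 1≤u u<w w≤N c no-solution cu csu with c 1 in c1
... | true  = refl
... | false = ⊥-elim (no-solution (solutionFor (c w) refl))
  where
  in-range : ∀ x → 1 ≤ x → x ≤ w → InRange N x
  in-range x 1≤x x≤w = 1≤x , ≤-trans x≤w w≤N

  1≤w : 1 ≤ w
  1≤w = ≤-trans (s≤s z≤n) u<w

  len-blocks : m ∸ 1 ≡ 1 + (suc u * u + t)
  len-blocks = trans len (trans (cong (suc u +_) w≡) (regroup u t))
    where
    regroup : ∀ u t → suc u + (u * u + t) ≡ 1 + (suc u * u + t)
    regroup = solve-∀

  solutionFor : ∀ col → c w ≡ col → MonoSolution m (2 + u) N c
  solutionFor true  cw = nearSolution m u t w len-blocks w≡
    (in-range u 1≤u (≤-trans (n≤1+n u) u<w) , cu) (in-range (suc u) (s≤s z≤n) u<w , csu)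
    (in-range w 1≤w ≤-refl , cw)
  solutionFor false cw = onesSolution m (suc u) w len
    (in-range 1 ≤-refl 1≤w , c1) (in-range w 1≤w ≤-refl , cw)

≤-⌈/⌉ : ∀ n d q .{{_ : NonZero d}} → d * q ≤ n + (d ∸ 1) → q ≤ ⌈ n / d ⌉
≤-⌈/⌉ n d q dq≤ = begin
  q                   ≡⟨ m*n/n≡m q d ⟨
  q * d / d           ≡⟨ cong (_/ d) (*-comm q d) ⟩
  d * q / d           ≤⟨ /-monoˡ-≤ d dq≤ ⟩
  (n + (d ∸ 1)) / d   ∎
  where open ≤-Reasoning

-- If m − 1 > a(a − 1) then m − 1 ≤ C(m,a): first ⌈(m − 1)/a⌉ ≥ a, and then
-- C(m,a) ≥ ⌈(m − 1)·a / a⌉ = m − 1.  (Here a = k + 1.)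
m∸1≤C : ∀ m k → suc k * suc k ≤ (m ∸ 1) + k → m ∸ 1 ≤ C m (suc k)
m∸1≤C m k a²≤ = ≤-⌈/⌉ (M * ⌈ M / a ⌉) a M (begin
  a * M               ≡⟨ *-comm a M ⟩
  M * a               ≤⟨ *-monoʳ-≤ M (≤-⌈/⌉ M a a a²≤) ⟩
  M * ⌈ M / a ⌉       ≤⟨ m≤m+n (M * ⌈ M / a ⌉) k ⟩
  M * ⌈ M / a ⌉ + k   ∎)
  where
  open ≤-Reasoning
  M a : ℕ
  M = m ∸ 1
  a = suc k

-- The hypothesis m ≥ 2a² − a + 2 for a = u + 2 reads m ≥ a + (2u² + 6u + 6).
threshold : ∀ u → 2 * (2 + u) ^ 2 ∸ (2 + u) + 2 ≡ (2 + u) + (2 * (u * u) + 6 * u + 6)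
threshold u = begin
  2 * (2 + u) ^ 2 ∸ (2 + u) + 2                        ≡⟨ cong (λ v → v ∸ (2 + u) + 2) (square u) ⟩
  (2 + u) + (2 * (u * u) + 7 * u + 6) ∸ (2 + u) + 2    ≡⟨ cong (_+ 2) (m+n∸m≡n (2 + u) _) ⟩
  2 * (u * u) + 7 * u + 6 + 2                          ≡⟨ regroup u ⟩
  (2 + u) + (2 * (u * u) + 6 * u + 6)                  ∎
  where
  open ≡-Reasoning
  square : ∀ u → 2 * ((2 + u) * ((2 + u) * 1)) ≡ (2 + u) + (2 * (u * u) + 7 * u + 6)
  square = solve-∀
  regroup : ∀ u → 2 * (u * u) + 7 * u + 6 + 2 ≡ (2 + u) + (2 * (u * u) + 6 * u + 6)
  regroup = solve-∀

-- The quantities for a = u + 2 and m = a + (2u² + 6u + 6) + s, i.e. an arbitrary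
-- m ≥ 2a² − a + 2: here w = m − a = u² + t with u < w ≤ C(m,a).
module Parameters (u s : ℕ) where

  L m w t : ℕ
  L = 2 * (u * u) + 6 * u + 6
  m = 2 + u + L + s
  w = L + s
  t = u * u + 6 * u + 6 + s

  len : m ∸ 1 ≡ suc u + w
  len = cong suc (+-assoc u L s)

  w≡ : w ≡ u * u + t
  w≡ = identity u s
    where
    identity : ∀ u s → 2 * (u * u) + 6 * u + 6 + s ≡ u * u + (u * u + 6 * u + 6 + s)
    identity = solve-∀

  u<w : suc u ≤ w
  u<w = subst (suc u ≤_) (sym (identity u s)) (m≤m+n (suc u) _)
    where
    identity : ∀ u s → 2 * (u * u) + 6 * u + 6 + s ≡ suc u + (2 * (u * u) + 5 * u + 5 + s)
    identity = solve-∀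

  -- m − 1 + (a − 1) = 2a² + s ≥ a², hence w ≤ m − 1 ≤ C(m,a).
  a²≤ : (2 + u) * (2 + u) ≤ (m ∸ 1) + suc u
  a²≤ = subst (λ v → (2 + u) * (2 + u) ≤ v + suc u) (sym len)
          (subst ((2 + u) * (2 + u) ≤_) (sym (identity u s)) (m≤m+n ((2 + u) * (2 + u)) _))
    where
    identity : ∀ u s → suc u + (2 * (u * u) + 6 * u + 6 + s) + suc u
                     ≡ (2 + u) * (2 + u) + ((2 + u) * (2 + u) + s)
    identity = solve-∀

  w≤C : w ≤ C m (2 + u)
  w≤C = ≤-trans (m≤n+m w (suc u)) (subst (_≤ C m (2 + u)) len (m∸1≤C m (suc u) a²≤))

lemma5 : (a m : ℕ) → 3 ≤ a → 2 * a ^ 2 ∸ a + 2 ≤ m →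
    (c : ℕ → Colour) →
    ¬ MonoSolution m a (C m a) c →
    c (a ∸ 2) ≡ red → c (a ∸ 1) ≡ red →
    c 1 ≡ red
lemma5 zero          m ()
lemma5 (suc zero)    m (s≤s ())
lemma5 (suc (suc u)) m (s≤s (s≤s 1≤u)) m-large c no-solution cu csu
  with m≤n⇒∃[o]m+o≡n (subst (_≤ m) (threshold u) m-large)
... | s , refl = oneIsRed m u t w len w≡ 1≤u u<w w≤C c no-solution cu csu
  where open Parameters u s using (w; t; len; w≡; u<w; w≤C)
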